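{- Let $T$ be a homeomorphically irreducible tree and let $s,s'$ be $T$-admissible sequences (not necessarily of the same length) with $\mathrm{sig}_s=\mathrm{sig}_{s'}$. Then for every integer $m>\max\{\mathrm{sig}_s(v):v\in V_{br}(T)\}$, the order of any tree induced by $s$ of degree $m$ equals the order of any tree induced by $s'$ of degree $m$.
   Context: A tree is homeomorphically irreducible if it has no vertex of degree two. $V_{br}(T)$ is the set of branch vertices (degree $\ge3$); an arm is a path from a branch vertex to a leaf with no branch vertex in between and an internal path is a path between two branch vertices with no other branch vertex in between; $\mathrm{dist}$ is distance in $T$. A rooted subtree has a designated root $\mathrm{rt}$; $T_\emptyset$ is the empty rooted tree. A $T$-admissible sequence is a finite sequence $t=\langle T_1,\dots,T_l\rangle$ of (possibly empty) rooted subtrees of $T$ such that $\{V(T_i)\}$ is a partition of $V_{br}(T)$ (empty blocks allowed). Its signature is $\mathrm{sig}_t(v)=\mathrm{dist}(v,\mathrm{rt}(T_i))+i$ for $v\in V(T_i)$. For an integer $m>\max\{\mathrm{sig}_t(v)\}$, a tree $T''$ is induced by $t$ of degree $m$ if obtained from $T$ in two stages. Stage 1 (unique tree $T'$): every arm of $T$ attached to a branch vertex $v$ is extended by $m-\mathrm{sig}_t(v)-1$ new vertices; for adjacent branch vertices $v\in V(T_i)$, $v'\in V(T_j)$ with $i\ne j$, the edge joining them is extended by $2m-\mathrm{sig}_t(v)-\mathrm{sig}_t(v')$ new vertices. Stage 2: for each $1\le i\le m$ with $T_i=T_\emptyset$ or $i\ge l+1$, insert $2(m-i)+1$ new vertices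 into some arm or some internal path of $T'$ not of length one (choices arbitrary; the same arm or path may be chosen repeatedly). -}

module Defs where

open import Data.Nat using (ℕ; zero; suc; _+_; _*_; _∸_; _≤_; _<_)
open import Data.Fin using (Fin; toℕ; _≟_)
open import Data.Fin.Subset using (Subset; _∈_)
open import Data.Product using (Σ; ∃; ∃-syntax; _×_; _,_; proj₁; proj₂)
open import Data.Sum using (_⊎_)
open import Data.List using (List; []; _∷_; length; _∷ʳ_; map; upTo)
open import Data.Nat.ListAction using (sum)
open import Data.List.Relation.Unary.Unique.Propositional using (Unique)
open import Data.Vec using (Vec; lookup)
open import Data.Maybe using (Maybe; just; nothing)
open import Data.Bool using (Bool; true; false; if_then_else_; _∨_)
open import Data.Unit using (⊤)
open import Data.Empty using (⊥)
open import Relation.Binary.PropositionalEquality using (_≡_; _≢_)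
open import Relation.Nullary using (¬_)
open import Relation.Nullary.Decidable using (⌊_⌋)

record Graph : Set where
  field
    n    : ℕ
    e    : ℕ
    ends : Fin e → Fin n × Fin n

module _ (G : Graph) where
  open Graph G

  Adjacent : Fin n → Fin n → Set
  Adjacent u v = ∃[ i ] (ends i ≡ (u , v) ⊎ ends i ≡ (v , u))

  data WalkIn (P : Fin n → Set) : Fin n → Fin n → ℕ → Set where
    here : ∀ {u} → P u → WalkIn P u u 0
    step : ∀ {u w v k} → P u → Adjacent u w → WalkIn P w v k → WalkIn P u v (suc k)

  Walk : Fin n → Fin n → ℕ → Set
  Walk = WalkIn (λ _ → ⊤)

  Dist : Fin n → Fin n → ℕ → Set
  Dist u v d = Walk u v d × (∀ k → Walk u v k → d ≤ k)

  Connected : Set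
  Connected = ∀ u v → ∃[ k ] Walk u v k

  data Chain : List (Fin n) → Set where
    []  : Chain []
    [-] : ∀ {x} → Chain (x ∷ [])
    _∷_ : ∀ {x y xs} → Adjacent x y → Chain (y ∷ xs) → Chain (x ∷ y ∷ xs)

  IsCycle : List (Fin n) → Set
  IsCycle []       = ⊥
  IsCycle (x ∷ ys) = 3 ≤ length (x ∷ ys) × Unique (x ∷ ys) × Chain ((x ∷ ys) ∷ʳ x)

  Simple : Set
  Simple = (∀ i → proj₁ (ends i) ≢ proj₂ (ends i))
         × (∀ i j u v → Adjacent-by i u v → Adjacent-by j u v → i ≡ j)
    where
    Adjacent-by : Fin e → Fin n → Fin n → Set
    Adjacent-by i u v = ends i ≡ (u , v) ⊎ ends i ≡ (v , u)

  IsTree : Set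
  IsTree = 0 < n × Simple × Connected × (∀ xs → ¬ IsCycle xs)

  countTrue : ∀ {k} → (Fin k → Bool) → ℕ
  countTrue {zero}  f = 0
  countTrue {suc k} f = (if f Fin.zero then 1 else 0) + countTrue (λ i → f (Fin.suc i))

  sumFin : ∀ {k} → (Fin k → ℕ) → ℕ
  sumFin {zero}  f = 0
  sumFin {suc k} f = f Fin.zero + sumFin (λ i → f (Fin.suc i))

  incident : Fin n → Fin e → Bool
  incident v i = ⌊ v ≟ proj₁ (ends i) ⌋ ∨ ⌊ v ≟ proj₂ (ends i) ⌋

  degree : Fin n → ℕ
  degree v = countTrue (incident v)

  IsBranch : Fin n → Set
  IsBranch v = 3 ≤ degree v

  IsLeaf : Fin n → Set
  IsLeaf v = degree v ≡ 1

  HomeomorphicallyIrreducible : Set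
  HomeomorphicallyIrreducible = ∀ v → degree v ≢ 2

  -- Arms / internal paths.  In a homeomorphically irreducible tree no
  -- vertex has degree 2, so every arm is a single edge branch–leaf and
  -- every internal path is a single edge branch–branch.
  ArmEdge : Fin e → Set
  ArmEdge i = (IsBranch (proj₁ (ends i)) × IsLeaf (proj₂ (ends i)))
            ⊎ (IsLeaf (proj₁ (ends i)) × IsBranch (proj₂ (ends i)))

  InternalEdge : Fin e → Set
  InternalEdge i = IsBranch (proj₁ (ends i)) × IsBranch (proj₂ (ends i))

data RootedSubtree (n : ℕ) : Set where
  ∅ₜ     : RootedSubtree n
  rooted : (S : Subset n) (r : Fin n) → RootedSubtree n

_∈V_ : ∀ {n} → Fin n → RootedSubtree n → Set
v ∈V ∅ₜ         = ⊥
v ∈V rooted S r = v ∈ S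

module _ (G : Graph) where
  open Graph G

  ValidSubtree : RootedSubtree n → Set
  ValidSubtree ∅ₜ         = ⊤
  ValidSubtree (rooted S r) =
    r ∈ S × (∀ u v → u ∈ S → v ∈ S → ∃[ k ] WalkIn G (_∈ S) u v k)

  -- T-admissible sequence ⟨T₁,…,T_l⟩ (block j : Fin l is T_{toℕ j + 1})
  IsAdmissible : ∀ {l} → Vec (RootedSubtree n) l → Set
  IsAdmissible t =
      (∀ j → ValidSubtree (lookup t j))
    × (∀ v → IsBranch G v → ∃[ j ] (v ∈V lookup t j))
    × (∀ v j j' → v ∈V lookup t j → v ∈V lookup t j' → j ≡ j')
    × (∀ v j → v ∈V lookup t j → IsBranch G v)

  IsSignature : ∀ {l} → Vec (RootedSubtree n) l → (Fin n → ℕ) → Set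
  IsSignature t σ = ∀ j S r → lookup t j ≡ rooted S r → ∀ v → v ∈ S →
    ∃[ d ] (Dist G v r d × σ v ≡ d + suc (toℕ j))

  SameBlock : ∀ {l} → Vec (RootedSubtree n) l → Fin n → Fin n → Set
  SameBlock t u v = ∃[ j ] (u ∈V lookup t j × v ∈V lookup t j)

  DiffBlocks : ∀ {l} → Vec (RootedSubtree n) l → Fin n → Fin n → Set
  DiffBlocks t u v = ∃[ j ] ∃[ j' ] (j ≢ j' × u ∈V lookup t j × v ∈V lookup t j')

  -- Stage 1: k₁ i = number of new vertices inserted on edge i of T to get T'
  Stage1 : ∀ {l} → Vec (RootedSubtree n) l → ℕ → (Fin n → ℕ) → (Fin e → ℕ) → Set
  Stage1 t m σ k₁ = ∀ i → let a = proj₁ (ends i) ; b = proj₂ (ends i) in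
      (IsBranch G a → IsLeaf G b → k₁ i ≡ m ∸ σ a ∸ 1)
    × (IsLeaf G a → IsBranch G b → k₁ i ≡ m ∸ σ b ∸ 1)
    × (IsBranch G a → IsBranch G b → DiffBlocks t a b → k₁ i ≡ 2 * m ∸ σ a ∸ σ b)
    × (IsBranch G a → IsBranch G b → SameBlock t a b → k₁ i ≡ 0)
    × (¬ IsBranch G a → ¬ IsBranch G b → k₁ i ≡ 0)

  -- index i (1-based) requires a Stage-2 insertion: T_i = T_∅ or i ≥ l+1
  NeedsFill : ∀ {l} → Vec (RootedSubtree n) l → ℕ → Set
  NeedsFill {l} t i = (∃[ j ] (suc (toℕ j) ≡ i × lookup t j ≡ ∅ₜ)) ⊎ (l < i)

  -- Stage 2 choice: c i = just x means the 2(m-i)+1 vertices for index i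
  -- go into the arm / internal path of T' coming from edge x of T
  Stage2 : ∀ {l} → Vec (RootedSubtree n) l → ℕ → (Fin e → ℕ) → (ℕ → Maybe (Fin e)) → Set
  Stage2 t m k₁ c =
      (∀ i → 1 ≤ i → i ≤ m → NeedsFill t i →
         ∃[ x ] (c i ≡ just x × (ArmEdge G x ⊎ InternalEdge G x)
                 × suc (k₁ x) ≢ 1))       -- length of that path of T' is not one
    × (∀ i → c i ≢ nothing → 1 ≤ i × i ≤ m × NeedsFill t i)

  hits : Maybe (Fin e) → Fin e → Bool
  hits nothing  x = false
  hits (just y) x = ⌊ y ≟ x ⌋

  stage2Extra : ℕ → (ℕ → Maybe (Fin e)) → Fin e → ℕ
  stage2Extra m c x =
    sum (map (λ j → if hits (c (suc j)) x then 2 * (m ∸ suc j) + 1 else 0) (upTo m))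

  -- T'' is the subdivision of T with k i new vertices on edge i,
  -- and it is induced by t of degree m
  IsInducedSubdivision : ∀ {l} → Vec (RootedSubtree n) l → ℕ → (Fin e → ℕ) → Set
  IsInducedSubdivision t m k =
    ∃[ σ ] (IsSignature t σ × (∀ v → IsBranch G v → σ v < m)
      × ∃[ k₁ ] (Stage1 t m σ k₁
        × ∃[ c ] (Stage2 t m k₁ c × (∀ x → k x ≡ k₁ x + stage2Extra m c x))))

  subdivisionOrder : (Fin e → ℕ) → ℕ
  subdivisionOrder k = n + sumFin G k

-- Give a branch vertex v the weight 2(m − sig v) + 1, and compare the number of
-- inserted vertices with what Stage 1 would insert if every branch vertex formed
-- a block of its own. The two differ only on edges inside a block, which receive
-- nothing instead of 2m − sig v − sig v′. Inside a block T_i the signature is the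
-- depth below the root shifted by i, so the ends of such an edge have signatures
-- differing by one and 2m − sig v − sig v′ is the weight of its deeper end. Every
-- non-root vertex of T_i is the deeper end of exactly one edge of T_i, and the
-- root has weight 2(m − i) + 1. Hence the total weight of the branch vertices is
-- the number of missing Stage-1 vertices plus 2(m − i) + 1 for each nonempty T_i,
-- while Stage 2 inserts 2(m − i) + 1 for exactly the other indices i ≤ m. So the
-- number of inserted vertices is the singleton Stage-1 count plus the sum of
-- 2(m − i) + 1 over i ≤ m minus the total weight, all determined by sig.
module Submission where

open import Defs
open import Data.Nat using (ℕ; zero; suc; _+_; _*_; _∸_; _≤_; _<_; z≤n; s≤s; s≤s⁻¹; _≤?_; _<?_)
open import Data.Nat.Properties hiding (_≟_)
open import Algebra.Properties.CommutativeSemigroup +-commutativeSemigroup using (interchange)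
open import Algebra.Properties.CommutativeMonoid.Sum +-0-commutativeMonoid
  using (sum; sum-syntax; sum-cong-≗; sum-replicate-zero; sum-remove; ∑-distrib-+; ∑-comm)
open import Data.Bool using (Bool; true; if_then_else_; _∨_)
open import Data.Bool.Properties using (∨-zeroʳ)
open import Data.Empty using (⊥; ⊥-elim)
open import Data.Fin using (Fin; toℕ; fromℕ<; zero; suc; _≟_)
open import Data.Fin.Properties using (punchInᵢ≢i; toℕ<n; toℕ-fromℕ<)
open import Data.Fin.Subset using (Subset; _∈_)
open import Data.Fin.Subset.Properties using (_∈?_)
open import Data.List using (List; []; _∷_; _∷ʳ_; length; map; applyUpTo)
open import Data.List.Properties using (length-++)
open import Data.List.Relation.Unary.All using (All; []; _∷_)
import Data.List.Relation.Unary.All as All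
open import Data.List.Relation.Unary.All.Properties using (∷ʳ⁺)
open import Data.List.Relation.Unary.AllPairs using ([]; _∷_)
open import Data.List.Relation.Unary.Unique.Propositional using (Unique)
open import Data.Maybe using (Maybe; just; nothing; maybe′)
import Data.Nat.ListAction as List
open import Data.Nat.Tactic.RingSolver using (solve-∀)
open import Data.Product using (∃-syntax; _×_; _,_; proj₁; proj₂)
open import Data.Sum using (_⊎_; inj₁; inj₂)
open import Data.Unit using (tt)
open import Data.Vec using (Vec; lookup; []; _∷_)
open import Data.Vec.Functional using (removeAt)
open import Function using (_∘_)
open import Relation.Binary using (tri<; tri≈; tri>)
open import Relation.Binary.PropositionalEquality
open import Relation.Nullary using (¬_; Dec; yes; no; contradiction; ¬?)
open import Relation.Nullary.Decidable using (⌊_⌋; _×-dec_; _⊎-dec_; dec-true; isYes≗does)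
open import Relation.Unary using (Pred; Decidable)

infixl 7 _when_

_when_ : ∀ {p} {P : Set p} → ℕ → Dec P → ℕ
x when yes _ = x
x when no _  = 0

when-yes : ∀ {p} {P : Set p} {x} → P → (P? : Dec P) → x when P? ≡ x
when-yes _ (yes _) = refl
when-yes p (no ¬p) = contradiction p ¬p

when-no : ∀ {p} {P : Set p} {x} → ¬ P → (P? : Dec P) → x when P? ≡ 0
when-no ¬p (yes p) = contradiction p ¬p
when-no _  (no _)  = refl

if-⌊⌋≡when : ∀ {p} {P : Set p} x (P? : Dec P) → (if ⌊ P? ⌋ then x else 0) ≡ x when P?
if-⌊⌋≡when x (yes _) = refl
if-⌊⌋≡when x (no _)  = refl

∑-zero : ∀ {k} {f : Fin k → ℕ} → (∀ i → f i ≡ 0) → sum f ≡ 0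
∑-zero {k} f≗0 = trans (sum-cong-≗ f≗0) (sum-replicate-zero k)

∑-single : ∀ {k} (f : Fin k → ℕ) i → (∀ j → j ≢ i → f j ≡ 0) → sum f ≡ f i
∑-single {suc k} f i off-i = begin
  sum f                      ≡⟨ sum-remove f ⟩
  f i + sum (removeAt f i)   ≡⟨ cong (f i +_) (∑-zero (λ j → off-i _ (punchInᵢ≢i i j))) ⟩
  f i + 0                    ≡⟨ +-identityʳ (f i) ⟩
  f i                        ∎
  where open ≡-Reasoning

module _ {k p} {P : Pred (Fin k) p} (P? : Decidable P) (f : Fin k → ℕ) where

  ∑-when-unique : ∀ {i} → P i → (∀ j → P j → j ≡ i) → ∑[ j < k ] (f j when P? j) ≡ f i
  ∑-when-unique {i} pi unique =
    trans (∑-single _ i (λ j j≢i → when-no (j≢i ∘ unique j) (P? j))) (when-yes pi (P? i))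

  ∑-when-none : (∀ j → ¬ P j) → ∑[ j < k ] (f j when P? j) ≡ 0
  ∑-when-none ¬P = ∑-zero (λ j → when-no (¬P j) (P? j))

∑-cutoff : ∀ {N K} (h : ℕ → ℕ) → N ≤ K → (∀ j → N ≤ j → h j ≡ 0) →
           ∑[ j < K ] h (toℕ j) ≡ ∑[ j < N ] h (toℕ j)
∑-cutoff {zero} {K} h _ vanish = ∑-zero {K} (λ j → vanish (toℕ j) z≤n)
∑-cutoff {suc N} h (s≤s N≤K) vanish =
  cong (h 0 +_) (∑-cutoff (h ∘ suc) N≤K (λ j N≤j → vanish (suc j) (s≤s N≤j)))

sumFin≡∑ : ∀ G {k} (f : Fin k → ℕ) → sumFin G f ≡ sum f
sumFin≡∑ G {zero}  f = refl
sumFin≡∑ G {suc k} f = cong (f zero +_) (sumFin≡∑ G (f ∘ suc))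

listSum-applyUpTo : ∀ (h : ℕ → ℕ) N (f : ℕ → ℕ) →
                    List.sum (map h (applyUpTo f N)) ≡ ∑[ j < N ] h (f (toℕ j))
listSum-applyUpTo h zero    f = refl
listSum-applyUpTo h (suc N) f = cong (h (f 0) +_) (listSum-applyUpTo h N (f ∘ suc))

unique-∷ʳ : ∀ {A : Set} {xs : List A} {y} → Unique xs → All (_≢ y) xs → Unique (xs ∷ʳ y)
unique-∷ʳ []               []              = [] ∷ []
unique-∷ʳ (x∉xs ∷ unique) (x≢y ∷ xs≢y) = ∷ʳ⁺ x∉xs x≢y ∷ unique-∷ʳ unique xs≢y

module TreeTheory (T : Graph) (simple : Simple T) (acyclic : ∀ xs → ¬ IsCycle T xs) where
  open Graph T

  adjacent-sym : ∀ {u v} → Adjacent T u v → Adjacent T v u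
  adjacent-sym (i , inj₁ p) = i , inj₂ p
  adjacent-sym (i , inj₂ p) = i , inj₁ p

  adjacent⇒≢ : ∀ {u v} → Adjacent T u v → u ≢ v
  adjacent⇒≢ (i , inj₁ p) refl = proj₁ simple i (trans (cong proj₁ p) (sym (cong proj₂ p)))
  adjacent⇒≢ (i , inj₂ p) refl = proj₁ simple i (trans (cong proj₁ p) (sym (cong proj₂ p)))

  dist-unique : ∀ {u v d d′} → Dist T u v d → Dist T u v d′ → d ≡ d′
  dist-unique (walk , minimal) (walk′ , minimal′) = ≤-antisym (minimal _ walk′) (minimal′ _ walk)

  dist-zero⇒≡ : ∀ {u v} → Dist T u v 0 → u ≡ v
  dist-zero⇒≡ (here _ , _) = refl

  dist-self : ∀ {u d} → Dist T u u d → d ≡ 0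
  dist-self (_ , minimal) = n≤0⇒n≡0 (minimal 0 (here tt))

  dist-suc⇒step : ∀ {v r d} → Dist T v r (suc d) → ∃[ w ] (Adjacent T v w × Dist T w r d)
  dist-suc⇒step (step _ vw walk , minimal) =
    _ , vw , walk , λ k walk′ → s≤s⁻¹ (minimal (suc k) (step tt vw walk′))

  dist-adjacent-≤ : ∀ {a b r x y} → Adjacent T a b → Dist T a r x → Dist T b r y → y ≤ suc x
  dist-adjacent-≤ ab (walk , _) (_ , minimal) = minimal _ (step tt (adjacent-sym ab) walk)

  data Path : Fin n → Fin n → List (Fin n) → Set where
    [-] : ∀ {a} → Path a a (a ∷ [])
    _∷_ : ∀ {a a′ b L} → Adjacent T a a′ → Path a′ b L → Path a b (a ∷ L)

  path-∷ʳ : ∀ {a b c L} → Path a b L → Adjacent T b c → Path a c (L ∷ʳ c)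
  path-∷ʳ [-]       bc = bc ∷ [-]
  path-∷ʳ (aa′ ∷ p) bc = aa′ ∷ path-∷ʳ p bc

  path⇒chain : ∀ {a b L} → Path a b L → Chain T L
  path⇒chain [-]             = [-]
  path⇒chain (ab ∷ [-])      = ab ∷ [-]
  path⇒chain (ab ∷ (bc ∷ p)) = ab ∷ path⇒chain (bc ∷ p)

  no-closed-path : ∀ {a b L} → Path a b L → 3 ≤ length L → Unique L → Adjacent T b a → ⊥
  no-closed-path [-]     (s≤s ()) _ _
  no-closed-path p@(_ ∷ _) long unique ba = acyclic _ (long , unique , path⇒chain (path-∷ʳ p ba))

  module Rooted (r : Fin n) where

    DepthAtMost : ℕ → Fin n → Set
    DepthAtMost D w = ∀ d → Dist T w r d → d ≤ D

    depth≤ : ∀ {u d D} → Dist T u r d → d ≤ D → DepthAtMost D u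
    depth≤ Du d≤D d Du′ = subst (_≤ _) (dist-unique Du Du′) d≤D

    depth-≢ : ∀ {u v x y} → Dist T u r x → Dist T v r y → x ≢ y → u ≢ v
    depth-≢ Du Dv x≢y refl = x≢y (dist-unique Du Dv)

    deeper-≢ : ∀ {u w D} → Dist T u r (suc D) → DepthAtMost D w → u ≢ w
    deeper-≢ Du shallow refl = 1+n≰n (shallow _ Du)

    -- The two ascending paths to the first common ancestor, glued together.
    same-depth-path : ∀ D {a b} → a ≢ b → Dist T a r D → Dist T b r D →
                    ∃[ L ] (Path a b L × Unique L × 3 ≤ length L × All (DepthAtMost D) L)
    same-depth-path zero a≢b Da Db = ⊥-elim (a≢b (trans (dist-zero⇒≡ Da) (sym (dist-zero⇒≡ Db))))
    same-depth-path (suc D) {a} {b} a≢b Da Db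
      with dist-suc⇒step Da | dist-suc⇒step Db
    ... | a′ , aa′ , Da′ | b′ , bb′ , Db′ with a′ ≟ b′
    ... | yes refl =
      a ∷ a′ ∷ b ∷ [] ,
      aa′ ∷ adjacent-sym bb′ ∷ [-] ,
      (depth-≢ Da Da′ (λ ()) ∷ a≢b ∷ []) ∷ (depth-≢ Da′ Db (λ ()) ∷ []) ∷ [] ∷ [] ,
      s≤s (s≤s (s≤s z≤n)) ,
      depth≤ Da ≤-refl ∷ depth≤ Da′ (n≤1+n D) ∷ depth≤ Db ≤-refl ∷ []
    ... | no a′≢b′ with same-depth-path D a′≢b′ Da′ Db′
    ... | L , p , unique , long , shallow =
      a ∷ (L ∷ʳ b) ,
      aa′ ∷ path-∷ʳ p (adjacent-sym bb′) ,
      ∷ʳ⁺ (All.map (deeper-≢ Da) shallow) a≢b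
        ∷ unique-∷ʳ unique (All.map (λ sh eq → deeper-≢ Db sh (sym eq)) shallow) ,
      ≤-trans long (≤-trans (m≤m+n (length L) 1) (≤-trans (≤-reflexive (sym (length-++ L))) (n≤1+n _))) ,
      depth≤ Da ≤-refl ∷ ∷ʳ⁺ (All.map (λ sh d Dw → m≤n⇒m≤1+n (sh d Dw)) shallow) (depth≤ Db ≤-refl)

    depth-adjacent : ∀ {a b x y} → Adjacent T a b → Dist T a r x → Dist T b r y →
                     x ≡ suc y ⊎ y ≡ suc x
    depth-adjacent {x = x} {y} ab Da Db with <-cmp x y
    ... | tri< x<y _ _ = inj₂ (≤-antisym (dist-adjacent-≤ ab Da Db) x<y)
    ... | tri> _ _ y<x = inj₁ (≤-antisym (dist-adjacent-≤ (adjacent-sym ab) Db Da) y<x)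
    ... | tri≈ _ refl _ with same-depth-path x (adjacent⇒≢ ab) Da Db
    ... | _ , p , unique , long , _ = ⊥-elim (no-closed-path p long unique (adjacent-sym ab))

    parent-unique : ∀ {u p p′ D} → Dist T u r (suc D) → Adjacent T u p → Adjacent T u p′ →
                    Dist T p r D → Dist T p′ r D → p ≡ p′
    parent-unique {p = p} {p′} {D} Du up up′ Dp Dp′ with p ≟ p′
    ... | yes p≡p′ = p≡p′
    ... | no p≢p′ with same-depth-path D p≢p′ Dp Dp′
    ... | _ , path , unique , long , shallow =
      ⊥-elim (no-closed-path (up ∷ path) (m≤n⇒m≤1+n long)
                             (All.map (deeper-≢ Du) shallow ∷ unique) (adjacent-sym up′))

    module _ {P : Fin n → Set} (depth : ∀ w → P w → ∃[ d ] Dist T w r d) where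

      data Descendant (v : Fin n) (dv : ℕ) : Fin n → ℕ → Set where
        self  : Descendant v dv v dv
        child : ∀ {p dp u} → Descendant v dv p dp → Dist T p r dp → Adjacent T p u →
                Descendant v dv u (suc dp)

      descendant-deeper : ∀ {v dv u du} → Descendant v dv u du → dv ≤ du
      descendant-deeper self              = ≤-refl
      descendant-deeper (child desc _ _) = m≤n⇒m≤1+n (descendant-deeper desc)

      walk-head : ∀ {u w k} → WalkIn T P u w k → P u
      walk-head (here pu)     = pu
      walk-head (step pu _ _) = pu

      -- Follow the walk to the root: it can only climb above the subtree of v
      -- through v's parent, since every other vertex of that subtree has its
      -- own parent inside it.
      parent-on-walk : ∀ {v D u du k} → Descendant v (suc D) u du → Dist T u r du →
                       WalkIn T P u r k → ∃[ p ] (P p × Adjacent T v p × Dist T p r D)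
      parent-on-walk desc Du (here _) with dist-self Du
      ... | refl with descendant-deeper desc
      ... | ()
      parent-on-walk desc Du (step _ uw rest) with depth _ (walk-head rest)
      ... | dw , Dw with depth-adjacent uw Du Dw
      ... | inj₂ refl = parent-on-walk (child desc Du uw) Dw rest
      ... | inj₁ refl with desc
      ...   | self = _ , walk-head rest , uw , Dw
      ...   | child desc′ Dp pu with parent-unique Du (adjacent-sym pu) uw Dp Dw
      ...     | refl = parent-on-walk desc′ Dp rest

      parent-within : ∀ {v D k} → Dist T v r (suc D) → WalkIn T P v r k →
                      ∃[ p ] (P p × Adjacent T v p × Dist T p r D)
      parent-within Dv walk = parent-on-walk self Dv walk

-- 2(m − i) + 1: the Stage-2 insertion for index i, and the weight of a branch
-- vertex of signature i.
slack : ℕ → ℕ → ℕ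
slack m i = 2 * (m ∸ i) + 1

internalCount : ℕ → ℕ → ℕ → ℕ
internalCount m s t = 2 * m ∸ s ∸ t

internalCount-comm : ∀ m s t → internalCount m s t ≡ internalCount m t s
internalCount-comm m s t = begin
  2 * m ∸ s ∸ t    ≡⟨ ∸-+-assoc (2 * m) s t ⟩
  2 * m ∸ (s + t)  ≡⟨ cong (2 * m ∸_) (+-comm s t) ⟩
  2 * m ∸ (t + s)  ≡⟨ ∸-+-assoc (2 * m) t s ⟨
  2 * m ∸ t ∸ s    ∎
  where open ≡-Reasoning

internalCount-parent : ∀ {m} s → suc s ≤ m → internalCount m (suc s) s ≡ slack m (suc s)
internalCount-parent s s<m with m≤n⇒∃[o]m+o≡n s<m
... | t , refl = begin
  2 * (suc s + t) ∸ suc s ∸ s              ≡⟨ cong (λ z → z ∸ suc s ∸ s) (expand s t) ⟩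
  (2 * t + 1) + s + suc s ∸ suc s ∸ s      ≡⟨ cong (_∸ s) (m+n∸n≡m ((2 * t + 1) + s) (suc s)) ⟩
  (2 * t + 1) + s ∸ s                      ≡⟨ m+n∸n≡m (2 * t + 1) s ⟩
  2 * t + 1                                ≡⟨ cong (λ z → 2 * z + 1) (m+n∸m≡n (suc s) t) ⟨
  2 * (suc s + t ∸ suc s) + 1              ∎
  where
  open ≡-Reasoning
  expand : ∀ s t → 2 * (suc s + t) ≡ (2 * t + 1) + s + suc s
  expand = solve-∀

module Ends (T : Graph) where
  open Graph T

  end₁ end₂ : Fin e → Fin n
  end₁ x = proj₁ (ends x)
  end₂ x = proj₂ (ends x)

module Weights (T : Graph) (σ : Fin (Graph.n T) → ℕ) (m : ℕ) where
  open Graph T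
  open Ends T

  weight : Fin n → ℕ
  weight v = slack m (σ v)

  internalCountAt : Fin e → ℕ
  internalCountAt x = internalCount m (σ (end₁ x)) (σ (end₂ x))

module Block (T : Graph) (simple : Simple T) (acyclic : ∀ xs → ¬ IsCycle T xs)
             (σ : Fin (Graph.n T) → ℕ) (m J : ℕ)
             (S : Subset (Graph.n T)) (r : Fin (Graph.n T)) (r∈S : r ∈ S)
             (connected : ∀ u → u ∈ S → ∃[ k ] WalkIn T (_∈ S) u r k)
             (level : ∀ v → v ∈ S → ∃[ d ] (Dist T v r d × σ v ≡ d + suc J))
             (σ<m : ∀ v → v ∈ S → σ v < m) where
  open Graph T
  open Ends T
  open Weights T σ m
  open TreeTheory T simple acyclic
  open Rooted r

  σ-depth : ∀ {v d} → v ∈ S → Dist T v r d → σ v ≡ d + suc J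
  σ-depth {v} v∈S Dv with level v v∈S
  ... | d , Dv′ , σv≡ = trans σv≡ (cong (_+ suc J) (dist-unique Dv′ Dv))

  σ-root : σ r ≡ suc J
  σ-root = σ-depth r∈S (here tt , λ _ _ → z≤n)

  σ-lower : ∀ {v} → v ∈ S → suc J ≤ σ v
  σ-lower {v} v∈S with level v v∈S
  ... | d , _ , σv≡ = subst (suc J ≤_) (sym σv≡) (m≤n+m (suc J) d)

  σ-adjacent : ∀ {a b} → a ∈ S → b ∈ S → Adjacent T a b → σ a ≡ suc (σ b) ⊎ σ b ≡ suc (σ a)
  σ-adjacent {a} {b} a∈S b∈S ab with level a a∈S | level b b∈S
  ... | da , Da , σa≡ | db , Db , σb≡ with depth-adjacent ab Da Db
  ... | inj₁ refl = inj₁ (trans σa≡ (cong suc (sym σb≡)))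
  ... | inj₂ refl = inj₂ (trans σb≡ (cong suc (sym σa≡)))

  Below : Fin n → Fin n → Set
  Below u w = u ∈ S × w ∈ S × σ w < σ u

  ChildEnd : Fin e → Fin n → Set
  ChildEnd x v = (v ≡ end₁ x × Below (end₁ x) (end₂ x)) ⊎ (v ≡ end₂ x × Below (end₂ x) (end₁ x))

  childEnd? : ∀ x v → Dec (ChildEnd x v)
  childEnd? x v = (v ≟ end₁ x ×-dec below? (end₁ x) (end₂ x))
            ⊎-dec (v ≟ end₂ x ×-dec below? (end₂ x) (end₁ x))
    where
    below? : ∀ u w → Dec (Below u w)
    below? u w = u ∈? S ×-dec w ∈? S ×-dec σ w <? σ u

  BothIn : Fin e → Set
  BothIn x = end₁ x ∈ S × end₂ x ∈ S

  bothIn? : ∀ x → Dec (BothIn x)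
  bothIn? x = end₁ x ∈? S ×-dec end₂ x ∈? S

  NonRoot : Fin n → Set
  NonRoot v = v ∈ S × v ≢ r

  nonRoot? : ∀ v → Dec (NonRoot v)
  nonRoot? v = v ∈? S ×-dec ¬? (v ≟ r)

  childEnd⇒bothIn : ∀ {x v} → ChildEnd x v → BothIn x
  childEnd⇒bothIn (inj₁ (_ , a∈S , b∈S , _)) = a∈S , b∈S
  childEnd⇒bothIn (inj₂ (_ , b∈S , a∈S , _)) = a∈S , b∈S

  childEnd-unique : ∀ {x u v} → ChildEnd x u → ChildEnd x v → u ≡ v
  childEnd-unique (inj₁ (refl , _))         (inj₁ (refl , _))         = refl
  childEnd-unique (inj₂ (refl , _))         (inj₂ (refl , _))         = refl
  childEnd-unique (inj₁ (_ , _ , _ , b<a)) (inj₂ (_ , _ , _ , a<b)) = ⊥-elim (<-asym b<a a<b)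
  childEnd-unique (inj₂ (_ , _ , _ , a<b)) (inj₁ (_ , _ , _ , b<a)) = ⊥-elim (<-asym b<a a<b)

  count-at-child : ∀ {u w} → u ∈ S → σ u ≡ suc (σ w) → internalCount m (σ u) (σ w) ≡ slack m (σ u)
  count-at-child {u} {w} u∈S σu≡ =
    subst (λ z → internalCount m z (σ w) ≡ slack m z) (sym σu≡)
          (internalCount-parent (σ w) (subst (_≤ m) σu≡ (<⇒≤ (σ<m u u∈S))))

  childEnd-exists : ∀ x → BothIn x →
                    ∃[ c ] (ChildEnd x c × internalCountAt x ≡ slack m (σ c))
  childEnd-exists x (a∈S , b∈S) with σ-adjacent a∈S b∈S (x , inj₁ refl)
  ... | inj₁ σa≡ = end₁ x , inj₁ (refl , a∈S , b∈S , ≤-reflexive (sym σa≡)) , count-at-child a∈S σa≡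
  ... | inj₂ σb≡ = end₂ x , inj₂ (refl , b∈S , a∈S , ≤-reflexive (sym σb≡)) ,
    trans (internalCount-comm m (σ (end₁ x)) (σ (end₂ x))) (count-at-child b∈S σb≡)

  Joins : Fin e → Fin n → Fin n → Set
  Joins x u w = ends x ≡ (u , w) ⊎ ends x ≡ (w , u)

  childEnd⇒below : ∀ {x v} → ChildEnd x v → ∃[ w ] (Below v w × Joins x v w)
  childEnd⇒below (inj₁ (refl , below)) = _ , below , inj₁ refl
  childEnd⇒below (inj₂ (refl , below)) = _ , below , inj₂ refl

  below⇒childEnd : ∀ {x v w} → Below v w → Joins x v w → ChildEnd x v
  below⇒childEnd below (inj₁ eq) =
    inj₁ (sym (cong proj₁ eq) , subst₂ Below (sym (cong proj₁ eq)) (sym (cong proj₂ eq)) below)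
  below⇒childEnd below (inj₂ eq) =
    inj₂ (sym (cong proj₂ eq) , subst₂ Below (sym (cong proj₂ eq)) (sym (cong proj₁ eq)) below)

  below⇒nonRoot : ∀ {v w} → Below v w → NonRoot v
  below⇒nonRoot (v∈S , w∈S , σw<σv) =
    v∈S , λ { refl → <⇒≱ σw<σv (subst (_≤ σ _) (sym σ-root) (σ-lower w∈S)) }

  below-depth : ∀ {v w} → Below v w → Adjacent T v w → ∃[ D ] (Dist T v r (suc D) × Dist T w r D)
  below-depth (v∈S , w∈S , σw<σv) vw with level _ v∈S | level _ w∈S
  ... | dv , Dv , σv≡ | dw , Dw , σw≡ with depth-adjacent vw Dv Dw
  ... | inj₁ refl = dw , Dv , Dw
  ... | inj₂ refl = ⊥-elim (<-asym σw<σv (subst₂ _<_ (sym σv≡) (sym σw≡) (n<1+n _)))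

  depthInS : ∀ w → w ∈ S → ∃[ d ] Dist T w r d
  depthInS w w∈S = proj₁ (level w w∈S) , proj₁ (proj₂ (level w w∈S))

  parent-edge : ∀ {v} → NonRoot v → ∃[ x ] ChildEnd x v
  parent-edge {v} (v∈S , v≢r) with level v v∈S
  ... | zero , Dv , _ = ⊥-elim (v≢r (dist-zero⇒≡ Dv))
  ... | suc D , Dv , σv≡ with parent-within depthInS Dv (proj₂ (connected v v∈S))
  ... | p , p∈S , (x , joins) , Dp =
    x , below⇒childEnd (v∈S , p∈S , subst₂ _<_ (sym (σ-depth p∈S Dp)) (sym σv≡) (n<1+n _)) joins

  parent-edge-unique : ∀ {x y v} → ChildEnd x v → ChildEnd y v → x ≡ y
  parent-edge-unique {x} {y} {v} ce ce′ with childEnd⇒below ce | childEnd⇒below ce′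
  ... | w , below , joins | w′ , below′ , joins′
    with below-depth below (x , joins) | below-depth below′ (y , joins′)
  ... | D , Dv , Dw | D′ , Dv′ , Dw′ with dist-unique Dv Dv′
  ... | refl with parent-unique Dv (x , joins) (y , joins′) Dw Dw′
  ... | refl = proj₂ simple x y v w joins joins′

  edge-weight : ∀ x → internalCountAt x when bothIn? x
                      ≡ ∑[ v < n ] (weight v when childEnd? x v)
  edge-weight x with bothIn? x
  ... | no ¬both = sym (∑-when-none (childEnd? x) weight (λ v ce → ¬both (childEnd⇒bothIn ce)))
  ... | yes both with childEnd-exists x both
  ... | c , ce , count≡ =
    trans count≡ (sym (∑-when-unique (childEnd? x) weight ce (λ v ce′ → childEnd-unique ce′ ce)))

  vertex-weight : ∀ v → ∑[ x < e ] (weight v when childEnd? x v) ≡ weight v when nonRoot? v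
  vertex-weight v with nonRoot? v
  ... | no ¬nonRoot = ∑-when-none (λ x → childEnd? x v) (λ _ → weight v)
                        (λ x ce → ¬nonRoot (below⇒nonRoot (proj₁ (proj₂ (childEnd⇒below ce)))))
  ... | yes nonRoot with parent-edge nonRoot
  ... | x , ce =
    ∑-when-unique (λ x → childEnd? x v) (λ _ → weight v) ce (λ y ce′ → parent-edge-unique ce′ ce)

  root-split : ∀ v → weight v when (v ∈? S) ≡ weight v when (v ≟ r) + weight v when nonRoot? v
  root-split v with v ≟ r | v ∈? S
  ... | yes refl | yes _   = sym (+-identityʳ (weight r))
  ... | yes refl | no r∉S  = contradiction r∈S r∉S
  ... | no _     | yes _   = refl
  ... | no _     | no _    = refl

  block-weight : ∑[ x < e ] (internalCountAt x when bothIn? x) + slack m (suc J)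
                 ≡ ∑[ v < n ] (weight v when (v ∈? S))
  block-weight = begin
    ∑[ x < e ] (internalCountAt x when bothIn? x) + slack m (suc J)
      ≡⟨ cong₂ _+_ (sum-cong-≗ edge-weight) (cong (slack m) (sym σ-root)) ⟩
    ∑[ x < e ] ∑[ v < n ] (weight v when childEnd? x v) + weight r
      ≡⟨ cong (_+ weight r) (∑-comm (λ x v → weight v when childEnd? x v)) ⟩
    ∑[ v < n ] ∑[ x < e ] (weight v when childEnd? x v) + weight r
      ≡⟨ cong (_+ weight r) (sum-cong-≗ vertex-weight) ⟩
    ∑[ v < n ] (weight v when nonRoot? v) + weight r
      ≡⟨ +-comm _ (weight r) ⟩
    weight r + ∑[ v < n ] (weight v when nonRoot? v)
      ≡⟨ cong (_+ ∑[ v < n ] (weight v when nonRoot? v))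
              (∑-when-unique (_≟ r) weight refl (λ _ v≡r → v≡r)) ⟨
    ∑[ v < n ] (weight v when (v ≟ r)) + ∑[ v < n ] (weight v when nonRoot? v)
      ≡⟨ ∑-distrib-+ (λ v → weight v when (v ≟ r)) (λ v → weight v when nonRoot? v) ⟨
    ∑[ v < n ] (weight v when (v ≟ r) + weight v when nonRoot? v)
      ≡⟨ sum-cong-≗ root-split ⟨
    ∑[ v < n ] (weight v when (v ∈? S))
      ∎
    where open ≡-Reasoning

countTrue-pos : ∀ G {k} (f : Fin k → Bool) i → f i ≡ true → 1 ≤ countTrue G f
countTrue-pos G f zero    fi≡true rewrite fi≡true = s≤s z≤n
countTrue-pos G f (suc i) fi≡true = ≤-trans (countTrue-pos G (f ∘ suc) i fi≡true) (m≤n+m _ _)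

module Degrees (T : Graph) (hi : HomeomorphicallyIrreducible T) where
  open Graph T
  open Ends T

  incident⇒leaf : ∀ {v} x → incident T v x ≡ true → ¬ IsBranch T v → IsLeaf T v
  incident⇒leaf {v} x incident≡true ¬branch
    with degree T v | countTrue-pos T (incident T v) x incident≡true | hi v
  ... | 1               | _ | _      = refl
  ... | 2               | _ | not-2  = contradiction refl not-2
  ... | suc (suc (suc _)) | _ | _    = contradiction (s≤s (s≤s (s≤s z≤n))) ¬branch

  ⌊≟⌋-refl : ∀ (v : Fin n) → ⌊ v ≟ v ⌋ ≡ true
  ⌊≟⌋-refl v = trans (isYes≗does (v ≟ v)) (dec-true (v ≟ v) refl)

  end₁-leaf : ∀ x → ¬ IsBranch T (end₁ x) → IsLeaf T (end₁ x)
  end₁-leaf x = incident⇒leaf {end₁ x} x (cong (_∨ ⌊ end₁ x ≟ end₂ x ⌋) (⌊≟⌋-refl (end₁ x)))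

  end₂-leaf : ∀ x → ¬ IsBranch T (end₂ x) → IsLeaf T (end₂ x)
  end₂-leaf x =
    incident⇒leaf {end₂ x} x (trans (cong (⌊ end₂ x ≟ end₁ x ⌋ ∨_) (⌊≟⌋-refl (end₂ x))) (∨-zeroʳ _))

_∈V?_ : ∀ {n} (v : Fin n) (t : RootedSubtree n) → Dec (v ∈V t)
v ∈V? ∅ₜ         = no λ ()
v ∈V? rooted S _ = v ∈? S

ifRooted : ∀ {n} → RootedSubtree n → ℕ → ℕ
ifRooted ∅ₜ           _ = 0
ifRooted (rooted _ _) x = x

-- Indices past the end read as T_∅, as Stage 2 treats i ≥ l + 1 like an empty block.
blockAt : ∀ {n l} → Vec (RootedSubtree n) l → ℕ → RootedSubtree n
blockAt []       _       = ∅ₜ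
blockAt (t ∷ _)  zero    = t
blockAt (_ ∷ ts) (suc j) = blockAt ts j

blockAt-toℕ : ∀ {n l} (ts : Vec (RootedSubtree n) l) j → blockAt ts (toℕ j) ≡ lookup ts j
blockAt-toℕ (_ ∷ _)  zero    = refl
blockAt-toℕ (_ ∷ ts) (suc j) = blockAt-toℕ ts j

blockAt-fromℕ< : ∀ {n l} (ts : Vec (RootedSubtree n) l) {j} (j<l : j < l) →
                 blockAt ts j ≡ lookup ts (fromℕ< j<l)
blockAt-fromℕ< ts j<l = trans (cong (blockAt ts) (sym (toℕ-fromℕ< j<l))) (blockAt-toℕ ts (fromℕ< j<l))

blockAt-beyond : ∀ {n l} (ts : Vec (RootedSubtree n) l) {j} → l ≤ j → blockAt ts j ≡ ∅ₜ
blockAt-beyond []       _         = refl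
blockAt-beyond (_ ∷ ts) (s≤s l≤j) = blockAt-beyond ts l≤j

module _ (G : Graph) {l} (ts : Vec (RootedSubtree (Graph.n G)) l) where

  needsFill⇒empty : ∀ j → NeedsFill G ts (suc j) → blockAt ts j ≡ ∅ₜ
  needsFill⇒empty j (inj₁ (i , refl , ti≡∅)) = trans (blockAt-toℕ ts i) ti≡∅
  needsFill⇒empty j (inj₂ l<suc-j)           = blockAt-beyond ts (s≤s⁻¹ l<suc-j)

  empty⇒needsFill : ∀ j → blockAt ts j ≡ ∅ₜ → NeedsFill G ts (suc j)
  empty⇒needsFill j tj≡∅ with j <? l
  ... | yes j<l =
    inj₁ (fromℕ< j<l , cong suc (toℕ-fromℕ< j<l) , trans (sym (blockAt-fromℕ< ts j<l)) tj≡∅)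
  ... | no j≮l  = inj₂ (s≤s (≮⇒≥ j≮l))

hits-sum : ∀ (G : Graph) (mc : Maybe (Fin (Graph.e G))) w →
           ∑[ x < Graph.e G ] (if hits G mc x then w else 0) ≡ maybe′ (λ _ → w) 0 mc
hits-sum G nothing  w = ∑-zero {Graph.e G} (λ _ → refl)
hits-sum G (just y) w = trans (sum-cong-≗ (λ x → if-⌊⌋≡when w (y ≟ x)))
                              (∑-when-unique (y ≟_) (λ _ → w) refl (λ _ y≡x → sym y≡x))

module Induced (T : Graph) (tree : IsTree T) (hi : HomeomorphicallyIrreducible T)
               (σ : Fin (Graph.n T) → ℕ) (m : ℕ) (σ<m : ∀ v → IsBranch T v → σ v < m) where
  open Graph T
  open Ends T
  open Weights T σ m
  open Degrees T hi

  simple : Simple T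
  simple = proj₁ (proj₂ tree)

  acyclic : ∀ xs → ¬ IsCycle T xs
  acyclic = proj₂ (proj₂ (proj₂ tree))

  open TreeTheory T simple acyclic using (dist-unique; dist-self)

  isBranch? : ∀ v → Dec (IsBranch T v)
  isBranch? v = 3 ≤? degree T v

  -- The Stage-1 count of edge x when its two ends lie in different blocks.
  separatedCount : ∀ x → Dec (IsBranch T (end₁ x)) → Dec (IsBranch T (end₂ x)) → ℕ
  separatedCount x (yes _) (yes _) = internalCountAt x
  separatedCount x (yes _) (no _)  = m ∸ σ (end₁ x) ∸ 1
  separatedCount x (no _)  (yes _) = m ∸ σ (end₂ x) ∸ 1
  separatedCount x (no _)  (no _)  = 0

  stage1Total : ℕ
  stage1Total = ∑[ x < e ] separatedCount x (isBranch? (end₁ x)) (isBranch? (end₂ x))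

  stage2Total : ℕ
  stage2Total = ∑[ j < m ] slack m (suc (toℕ j))

  module Sequence {l} (s : Vec (RootedSubtree n) l) (admissible : IsAdmissible T s)
                  (signature : IsSignature T s σ) where

    covered : ∀ v → IsBranch T v → ∃[ j ] (v ∈V lookup s j)
    covered = proj₁ (proj₂ admissible)

    disjoint : ∀ v j j′ → v ∈V lookup s j → v ∈V lookup s j′ → j ≡ j′
    disjoint = proj₁ (proj₂ (proj₂ admissible))

    onlyBranch : ∀ v j → v ∈V lookup s j → IsBranch T v
    onlyBranch = proj₂ (proj₂ (proj₂ admissible))

    BothIn : Fin e → Fin l → Set
    BothIn x j = end₁ x ∈V lookup s j × end₂ x ∈V lookup s j

    bothIn? : ∀ x j → Dec (BothIn x j)
    bothIn? x j = end₁ x ∈V? lookup s j ×-dec end₂ x ∈V? lookup s j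

    sameBlockCount : Fin e → ℕ
    sameBlockCount x = ∑[ j < l ] (internalCountAt x when bothIn? x j)

    blockRootSlack : Fin l → ℕ
    blockRootSlack j = ifRooted (lookup s j) (slack m (suc (toℕ j)))

    rootSlack : ℕ
    rootSlack = ∑[ j < l ] blockRootSlack j

    block-weight : ∀ j → ∑[ v < n ] (weight v when (v ∈V? lookup s j))
                         ≡ ∑[ x < e ] (internalCountAt x when bothIn? x j) + blockRootSlack j
    block-weight j with lookup s j in tj≡
    ... | ∅ₜ = trans (∑-zero {n} (λ _ → refl)) (sym (trans (+-identityʳ _) (∑-zero {e} (λ _ → refl))))
    ... | rooted S r =
      sym (Block.block-weight T simple acyclic σ m (toℕ j) S r r∈S
             (λ u u∈S → proj₂ valid u r u∈S r∈S)
             (signature j S r tj≡)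
             (λ v v∈S → σ<m v (onlyBranch v j (subst (v ∈V_) (sym tj≡) v∈S))))
      where
      valid : ValidSubtree T (rooted S r)
      valid = subst (ValidSubtree T) tj≡ (proj₁ admissible j)
      r∈S : r ∈ S
      r∈S = proj₁ valid

    branch-split : ∀ v → weight v when isBranch? v ≡ ∑[ j < l ] (weight v when (v ∈V? lookup s j))
    branch-split v with isBranch? v
    ... | no ¬branch = sym (∑-when-none (λ j → v ∈V? lookup s j) (λ _ → weight v)
                                         (λ j v∈ → ¬branch (onlyBranch v j v∈)))
    ... | yes branch with covered v branch
    ... | j , v∈ = sym (∑-when-unique (λ j → v ∈V? lookup s j) (λ _ → weight v) v∈
                                       (λ j′ v∈′ → disjoint v j′ j v∈′ v∈))

    branch-weight : ∑[ v < n ] (weight v when isBranch? v) ≡ ∑[ x < e ] sameBlockCount x + rootSlack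
    branch-weight = begin
      ∑[ v < n ] (weight v when isBranch? v)
        ≡⟨ sum-cong-≗ branch-split ⟩
      ∑[ v < n ] ∑[ j < l ] (weight v when (v ∈V? lookup s j))
        ≡⟨ ∑-comm (λ v j → weight v when (v ∈V? lookup s j)) ⟩
      ∑[ j < l ] ∑[ v < n ] (weight v when (v ∈V? lookup s j))
        ≡⟨ sum-cong-≗ block-weight ⟩
      ∑[ j < l ] (∑[ x < e ] (internalCountAt x when bothIn? x j) + blockRootSlack j)
        ≡⟨ ∑-distrib-+ (λ j → ∑[ x < e ] (internalCountAt x when bothIn? x j)) blockRootSlack ⟩
      ∑[ j < l ] ∑[ x < e ] (internalCountAt x when bothIn? x j) + rootSlack
        ≡⟨ cong (_+ rootSlack) (∑-comm (λ j x → internalCountAt x when bothIn? x j)) ⟩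
      ∑[ x < e ] sameBlockCount x + rootSlack
        ∎
      where open ≡-Reasoning

    signature-unique : ∀ {σ₁} → IsSignature T s σ₁ → ∀ v → IsBranch T v → σ₁ v ≡ σ v
    signature-unique sig₁ v branch with covered v branch
    ... | j , v∈ with lookup s j in tj≡
    ...   | ∅ₜ = ⊥-elim v∈
    ...   | rooted S r with sig₁ j S r tj≡ v v∈ | signature j S r tj≡ v v∈
    ...     | d₁ , D₁ , σ₁v≡ | d , D , σv≡ =
      trans σ₁v≡ (trans (cong (_+ suc (toℕ j)) (dist-unique D₁ D)) (sym σv≡))

    sameBlockCount-none : ∀ x → (∀ j → ¬ BothIn x j) → sameBlockCount x ≡ 0
    sameBlockCount-none x ¬both = ∑-when-none (bothIn? x) (λ _ → internalCountAt x) ¬both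

    module _ {σ₁ k₁} (sig₁ : IsSignature T s σ₁) (stage1 : Stage1 T s m σ₁ k₁) where

      stage1-count : ∀ x da db → k₁ x + sameBlockCount x ≡ separatedCount x da db
      stage1-count x da db with stage1 x | da | db
      ... | arm , _ , _ , _ , _ | yes a-branch | no ¬b-branch =
        trans (cong₂ _+_ (trans (arm a-branch (end₂-leaf x ¬b-branch))
                                (cong (λ z → m ∸ z ∸ 1) (signature-unique sig₁ _ a-branch)))
                         (sameBlockCount-none x (λ j (_ , b∈) → ¬b-branch (onlyBranch _ j b∈))))
              (+-identityʳ _)
      ... | _ , arm , _ , _ , _ | no ¬a-branch | yes b-branch =
        trans (cong₂ _+_ (trans (arm (end₁-leaf x ¬a-branch) b-branch)
                                (cong (λ z → m ∸ z ∸ 1) (signature-unique sig₁ _ b-branch)))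
                         (sameBlockCount-none x (λ j (a∈ , _) → ¬a-branch (onlyBranch _ j a∈))))
              (+-identityʳ _)
      ... | _ , _ , _ , _ , neither | no ¬a-branch | no ¬b-branch =
        cong₂ _+_ (neither ¬a-branch ¬b-branch)
                  (sameBlockCount-none x (λ j (a∈ , _) → ¬a-branch (onlyBranch _ j a∈)))
      ... | _ , _ , across , within , _ | yes a-branch | yes b-branch
        with covered (end₁ x) a-branch | covered (end₂ x) b-branch
      ... | i , a∈ | j , b∈ with i ≟ j
      ... | yes refl =
        cong₂ _+_ (within a-branch b-branch (i , a∈ , b∈))
                  (∑-when-unique (bothIn? x) (λ _ → internalCountAt x) (a∈ , b∈)
                                 (λ j′ (a∈′ , _) → disjoint (end₁ x) j′ i a∈′ a∈))
      ... | no i≢j =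
        trans (cong₂ _+_ (trans (across a-branch b-branch (i , j , i≢j , a∈ , b∈))
                                (cong₂ (internalCount m) (signature-unique sig₁ _ a-branch)
                                                         (signature-unique sig₁ _ b-branch)))
                         (sameBlockCount-none x separated))
              (+-identityʳ (internalCountAt x))
        where
        separated : ∀ j′ → ¬ BothIn x j′
        separated j′ (a∈′ , b∈′) = i≢j (trans (disjoint _ i j′ a∈ a∈′) (disjoint _ j′ j b∈′ b∈))

      stage1-total : ∑[ x < e ] k₁ x + ∑[ x < e ] sameBlockCount x ≡ stage1Total
      stage1-total = trans (sym (∑-distrib-+ k₁ sameBlockCount))
                           (sum-cong-≗ (λ x → stage1-count x (isBranch? (end₁ x)) (isBranch? (end₂ x))))

    root-index<m : ∀ j {S r} → lookup s j ≡ rooted S r → suc (toℕ j) < m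
    root-index<m j {S} {r} tj≡ with proj₁ (subst (ValidSubtree T) tj≡ (proj₁ admissible j))
    ... | r∈S with signature j S r tj≡ r r∈S
    ... | d , Dr , σr≡ =
      subst (_< m) (trans σr≡ (cong (_+ suc (toℕ j)) (dist-self Dr)))
            (σ<m r (onlyBranch r j (subst (r ∈V_) (sym tj≡) r∈S)))

    rootSlackAt : ℕ → ℕ
    rootSlackAt J = ifRooted (blockAt s J) (slack m (suc J))

    rootSlackAt-toℕ : ∀ j → blockRootSlack j ≡ rootSlackAt (toℕ j)
    rootSlackAt-toℕ j = cong (λ t → ifRooted t (slack m (suc (toℕ j)))) (sym (blockAt-toℕ s j))

    rootSlackAt-past-l : ∀ J → l ≤ J → rootSlackAt J ≡ 0
    rootSlackAt-past-l J l≤J = cong (λ t → ifRooted t (slack m (suc J))) (blockAt-beyond s l≤J)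

    rootSlackAt-past-m : ∀ J → m ≤ J → rootSlackAt J ≡ 0
    rootSlackAt-past-m J m≤J with J <? l
    ... | no J≮l = rootSlackAt-past-l J (≮⇒≥ J≮l)
    ... | yes J<l rewrite blockAt-fromℕ< s J<l with lookup s (fromℕ< J<l) in tj≡
    ...   | ∅ₜ = refl
    ...   | rooted _ _ =
      contradiction (subst (λ i → suc i < m) (toℕ-fromℕ< J<l) (root-index<m _ tj≡)) (≤⇒≯ (m≤n⇒m≤1+n m≤J))

    rootSlack≡ : rootSlack ≡ ∑[ j < m ] rootSlackAt (toℕ j)
    rootSlack≡ = trans (sum-cong-≗ rootSlackAt-toℕ) (truncate (≤-total m l))
      where
      truncate : m ≤ l ⊎ l ≤ m → ∑[ j < l ] rootSlackAt (toℕ j) ≡ ∑[ j < m ] rootSlackAt (toℕ j)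
      truncate (inj₁ m≤l) = ∑-cutoff rootSlackAt m≤l rootSlackAt-past-m
      truncate (inj₂ l≤m) = sym (∑-cutoff rootSlackAt l≤m rootSlackAt-past-l)

    module _ {k₁ c} (stage2 : Stage2 T s m k₁ c) where

      filled : ℕ → ℕ
      filled J = maybe′ (λ _ → slack m (suc J)) 0 (c (suc J))

      stage2-total : ∑[ x < e ] stage2Extra T m c x ≡ ∑[ j < m ] filled (toℕ j)
      stage2-total = begin
        ∑[ x < e ] stage2Extra T m c x
          ≡⟨ sum-cong-≗ (λ x → listSum-applyUpTo (term x) m (λ j → j)) ⟩
        ∑[ x < e ] ∑[ j < m ] term x (toℕ j)
          ≡⟨ ∑-comm {e} {m} (λ x j → term x (toℕ j)) ⟩
        ∑[ j < m ] ∑[ x < e ] term x (toℕ j)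
          ≡⟨ sum-cong-≗ {m} (λ j → hits-sum T (c (suc (toℕ j))) (slack m (suc (toℕ j)))) ⟩
        ∑[ j < m ] filled (toℕ j)
          ∎
        where
        open ≡-Reasoning
        term : Fin e → ℕ → ℕ
        term x j = if hits T (c (suc j)) x then slack m (suc j) else 0

      filled-or-rooted : ∀ J → J < m → filled J + rootSlackAt J ≡ slack m (suc J)
      filled-or-rooted J J<m with c (suc J) in cJ≡
      ... | just _ =
        trans (cong (λ t → slack m (suc J) + ifRooted t (slack m (suc J)))
                    (needsFill⇒empty T s J needsFill))
              (+-identityʳ _)
        where
        chosen : c (suc J) ≢ nothing
        chosen cJ≡nothing = contradiction (trans (sym cJ≡) cJ≡nothing) λ ()
        needsFill : NeedsFill T s (suc J)
        needsFill = proj₂ (proj₂ (proj₂ stage2 (suc J) chosen))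
      ... | nothing with blockAt s J in tJ≡
      ...   | rooted _ _ = refl
      ...   | ∅ₜ with proj₁ stage2 (suc J) (s≤s z≤n) J<m (empty⇒needsFill T s J tJ≡)
      ...     | _ , cJ≡just , _ = contradiction (trans (sym cJ≡) cJ≡just) λ ()

      stage2-and-roots : ∑[ x < e ] stage2Extra T m c x + rootSlack ≡ stage2Total
      stage2-and-roots = begin
        ∑[ x < e ] stage2Extra T m c x + rootSlack
          ≡⟨ cong₂ _+_ stage2-total rootSlack≡ ⟩
        ∑[ j < m ] filled (toℕ j) + ∑[ j < m ] rootSlackAt (toℕ j)
          ≡⟨ ∑-distrib-+ {m} (filled ∘ toℕ) (rootSlackAt ∘ toℕ) ⟨
        ∑[ j < m ] (filled (toℕ j) + rootSlackAt (toℕ j))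
          ≡⟨ sum-cong-≗ (λ j → filled-or-rooted (toℕ j) (toℕ<n j)) ⟩
        stage2Total
          ∎
        where open ≡-Reasoning

    order-identity : ∀ {k} → IsInducedSubdivision T s m k →
                     sumFin T k + ∑[ v < n ] (weight v when isBranch? v) ≡ stage1Total + stage2Total
    order-identity {k} (σ₁ , sig₁ , _ , k₁ , stage1 , c , stage2 , k≡) = begin
      sumFin T k + ∑[ v < n ] (weight v when isBranch? v)
        ≡⟨ cong₂ _+_ (trans (sumFin≡∑ T k) (trans (sum-cong-≗ k≡) (∑-distrib-+ k₁ (stage2Extra T m c))))
                     branch-weight ⟩
      (∑[ x < e ] k₁ x + ∑[ x < e ] stage2Extra T m c x) + (∑[ x < e ] sameBlockCount x + rootSlack)
        ≡⟨ interchange (∑[ x < e ] k₁ x) (∑[ x < e ] stage2Extra T m c x)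
                       (∑[ x < e ] sameBlockCount x) rootSlack ⟩
      (∑[ x < e ] k₁ x + ∑[ x < e ] sameBlockCount x) + (∑[ x < e ] stage2Extra T m c x + rootSlack)
        ≡⟨ cong₂ _+_ (stage1-total sig₁ stage1) (stage2-and-roots stage2) ⟩
      stage1Total + stage2Total
        ∎
      where open ≡-Reasoning

theorem3p11 : (T : Graph) → IsTree T → HomeomorphicallyIrreducible T →
    ∀ {l l'} (s : Vec (RootedSubtree (Graph.n T)) l) (s' : Vec (RootedSubtree (Graph.n T)) l') →
    IsAdmissible T s → IsAdmissible T s' →
    (σ : Fin (Graph.n T) → ℕ) → IsSignature T s σ → IsSignature T s' σ →
    (m : ℕ) → (∀ v → IsBranch T v → σ v < m) →
    (k k' : Fin (Graph.e T) → ℕ) →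
    IsInducedSubdivision T s m k → IsInducedSubdivision T s' m k' →
    subdivisionOrder T k ≡ subdivisionOrder T k'
theorem3p11 T tree hi s s' adm adm' σ sig sig' m σ<m k k' induced induced' =
  cong (Graph.n T +_) (+-cancelʳ-≡ _ _ _ (trans (Sequence.order-identity s adm sig induced)
                                                (sym (Sequence.order-identity s' adm' sig' induced'))))
  where open Induced T tree hi σ m σ<m
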